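{- Let $n\ge2$. Then $$\sum_{\mathrm{PF}\in E^{\mathrm{PF}}_{n,1}}t^{\operatorname{area}(\mathrm{PF})}=t^{\,n-1}\sum_{\mathrm{PF}\in \mathcal{Q}_{n-1,n}}t^{\operatorname{rarea}(\mathrm{PF})}.$$
   Context: A classical parking function of size $n$ is defined as follows. Take a lattice path from $(0,0)$ to $(n,n)$ with unit north and east steps staying weakly above $y=x$. Label the $n$ cells immediately east of its north steps bijectively with $1,\dots,n$, increasing upward within each column. $E^{\mathrm{PF}}_{n,1}$ is the set of classical parking functions whose path meets the line $y=x$ only at $(0,0)$ and $(n,n)$. For such $\mathrm{PF}$, $\operatorname{area}(\mathrm{PF})$ is the number of unit cells lying between the path and the line $y=x$. $\mathcal{Q}_{n-1,n}$ is the set of $(n-1,n)$-parking functions. Each consists of a lattice path from $(0,0)$ to $(n-1,n)$ with unit north and east steps staying weakly above $y=\frac{n}{n-1}x$, with the $n$ cells immediately east of its north steps labeled bijectively by $1,\dots,n$, increasing upward within columns. $\operatorname{rarea}(\mathrm{PF})$ is the number of full unit cells lying between the path and the line $y=\frac{n}{n-1}x$. -}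

module Defs where

open import Data.Nat using (ℕ; zero; suc; _+_; _*_; _∸_; _≤ᵇ_; _<ᵇ_; _≡ᵇ_)
open import Data.Bool using (Bool; true; false; _∧_; _∨_; not; if_then_else_)
open import Data.List using (List; []; _∷_; map; filter; length; concatMap; upTo; foldr; _++_; sum)
open import Data.Product using (_×_; _,_; proj₁; proj₂)
open import Relation.Nullary.Decidable using (Dec; yes; no)
open import Data.Bool.Properties using () renaming (_≟_ to _≟ᵇ_)
open import Relation.Binary.PropositionalEquality using (_≡_)

-- Lattice paths: words in unit North / East steps starting at (0,0).

data Step : Set where
  N E : Step

Path : Set
Path = List Step

-- All words with exactly a East steps and b North steps (paths (0,0) → (a,b)).
words : ℕ → ℕ → List Path
words zero    zero    = [] ∷ []
words zero    (suc b) = map (N ∷_) (words zero b)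
words (suc a) zero    = map (E ∷_) (words a zero)
words (suc a) (suc b) = map (E ∷_) (words a (suc b)) ++ map (N ∷_) (words (suc a) b)

pointsFrom : ℕ → ℕ → Path → List (ℕ × ℕ)
pointsFrom x y []       = []
pointsFrom x y (N ∷ p) = (x , suc y) ∷ pointsFrom x (suc y) p
pointsFrom x y (E ∷ p) = (suc x , y) ∷ pointsFrom (suc x) y p

points : Path → List (ℕ × ℕ)
points p = (0 , 0) ∷ pointsFrom 0 0 p

-- x-coordinates of the North steps, listed bottom to top
-- (the j-th entry is the column of the cell immediately east of the
-- North step in row j).
northXsFrom : ℕ → Path → List ℕ
northXsFrom x []      = []
northXsFrom x (N ∷ p) = x ∷ northXsFrom x p
northXsFrom x (E ∷ p) = northXsFrom (suc x) p

northXs : Path → List ℕ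
northXs = northXsFrom 0

all : {A : Set} → (A → Bool) → List A → Bool
all f = foldr (λ x r → f x ∧ r) true

count : {A : Set} → (A → Bool) → List A → ℕ
count f xs = length (filter (λ x → f x ≟ᵇ true) xs)

-- Point (x,y) lies weakly above the line y = (b/a) x  ⇔  a*y ≥ b*x.
weaklyAbove : ℕ → ℕ → ℕ × ℕ → Bool
weaklyAbove a b (x , y) = (b * x) ≤ᵇ (a * y)

isDyckPath : ℕ → ℕ → Path → Bool
isDyckPath a b p = all (weaklyAbove a b) (points p)

interior : List (ℕ × ℕ) → List (ℕ × ℕ)
interior []       = []
interior (_ ∷ xs) = dropLast xs
  where
  dropLast : List (ℕ × ℕ) → List (ℕ × ℕ)
  dropLast []       = []
  dropLast (_ ∷ []) = []
  dropLast (z ∷ zs@(_ ∷ _)) = z ∷ dropLast zs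

-- Classical path (a = b = n) touching y = x only at (0,0) and (n,n):
-- every other visited point (x,y) has y > x.
touchesOnlyEnds : Path → Bool
touchesOnlyEnds p = all (λ { (x , y) → x <ᵇ y }) (interior (points p))

insertions : ℕ → List ℕ → List (List ℕ)
insertions x []       = (x ∷ []) ∷ []
insertions x (y ∷ ys) = (x ∷ y ∷ ys) ∷ map (y ∷_) (insertions x ys)

perms : List ℕ → List (List ℕ)
perms []       = [] ∷ []
perms (x ∷ xs) = concatMap (insertions x) (perms xs)

oneTo : ℕ → List ℕ
oneTo n = map suc (upTo n)

-- Labels (listed bottom to top, one per North step) increase upward within
-- each column: consecutive North steps in the same column have increasing labels.
colIncreasing : List ℕ → List ℕ → Bool
colIncreasing (x ∷ x' ∷ xs) (l ∷ l' ∷ ls) =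
  ((not (x ≡ᵇ x')) ∨ (l <ᵇ l')) ∧ colIncreasing (x' ∷ xs) (l' ∷ ls)
colIncreasing _ _ = true

-- (a,b)-parking functions: a path (0,0) → (a,b) weakly above y = (b/a)x,
-- together with a bijective labelling by 1..b of the cells east of its
-- North steps (labels listed bottom-to-top), increasing in columns.

LabeledPath : Set
LabeledPath = Path × List ℕ

candidates : ℕ → ℕ → List LabeledPath
candidates a b = concatMap (λ p → map (p ,_) (perms (oneTo b))) (words a b)

isPF : ℕ → ℕ → LabeledPath → Bool
isPF a b (p , ls) = isDyckPath a b p ∧ colIncreasing (northXs p) ls

Q : ℕ → ℕ → List LabeledPath
Q a b = filter (λ q → isPF a b q ≟ᵇ true) (candidates a b)

EPF : ℕ → List LabeledPath
EPF n = filter (λ q → (isPF n n q ∧ touchesOnlyEnds (proj₁ q)) ≟ᵇ true) (candidates n n)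

-- Area: number of full unit cells [i,i+1]×[j,j+1] (0 ≤ i < a, 0 ≤ j < b)
-- lying between the path and the line y = (b/a)x, i.e. cells to the right
-- of the path in their row (i ≥ x-coordinate of the North step of row j)
-- and entirely above the line (b*(i+1) ≤ a*j).

rowCells : ℕ → ℕ → ℕ → ℕ → ℕ
rowCells a b j xj = count (λ i → (xj ≤ᵇ i) ∧ ((b * suc i) ≤ᵇ (a * j))) (upTo a)

cellsFrom : ℕ → ℕ → ℕ → List ℕ → ℕ
cellsFrom a b j []        = 0
cellsFrom a b j (xj ∷ xs) = rowCells a b j xj + cellsFrom a b (suc j) xs

rarea : ℕ → ℕ → Path → ℕ
rarea a b p = cellsFrom a b 0 (northXs p)

area : ℕ → Path → ℕ
area n p = rarea n n p

-- Generating functions: a polynomial in t with ℕ coefficients is represented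
-- by its coefficient function; gf xs stat k = coefficient of t^k in
-- Σ_{x ∈ xs} t^{stat x}.

gf : {A : Set} → List A → (A → ℕ) → ℕ → ℕ
gf xs stat k = count (λ x → stat x ≡ᵇ k) xs

-- Coefficient of t^k in t^s · P(t), where P has coefficient function c.
shiftT : ℕ → (ℕ → ℕ) → ℕ → ℕ
shiftT s c k = if s ≤ᵇ k then c (k ∸ s) else 0

module Submission where

-- Write n = m + 1.  A path from (0,0) to (n,n) touching the diagonal only at
-- its ends must finish with an East step (a final North step would start at
-- (n, n-1), below the diagonal), and deleting that step leaves a path p from
-- (0,0) to (m, m+1).  Since p has at most m East steps, a visited point other
-- than the origin lies weakly above the steep line y = (m+1)x/m exactly when it
-- lies strictly above the diagonal; hence p is an (m, m+1)-Dyck path exactly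
-- when p·E meets the diagonal only at its ends.  Deleting the last East step
-- keeps the column of every North step, so the admissible labellings agree,
-- and row by row exactly one cell of area is lost in each of the rows 1,…,m,
-- so area(p·E) = m + rarea(p).
--
-- The theorem then compares the two sides labelling by
-- labelling after splitting the words (0,0) → (n,n) by their last step.

open import Defs
open import Data.Nat using (ℕ; zero; suc; _+_; _*_; _∸_; _⊓_; _≤_; _<_; _≤ᵇ_; _<ᵇ_; _≡ᵇ_; z≤n; s≤s; z<s; _≤?_; _<?_)
open import Data.Nat.Properties
open import Data.Bool using (Bool; true; false; _∧_; T)
open import Data.Bool.Properties using (∧-assoc; ∧-zeroʳ; ∧-identityʳ; T-≡; T-∧) renaming (_≟_ to _≟ᵇ_)
open import Data.List using (List; []; _∷_; _∷ʳ_; _++_; [_]; map; filter; length; concatMap; upTo)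
open import Data.List.Properties using (filter-++; length-++; map-++; map-∘; map-cong; applyUpTo-∷ʳ)
open import Data.Nat.ListAction using (sum)
open import Data.Nat.ListAction.Properties using (sum-++)
open import Data.Product using (_×_; _,_; proj₁; proj₂)
open import Data.Sum using (_⊎_; inj₁; inj₂)
open import Data.Unit using (tt)
open import Data.Empty using (⊥; ⊥-elim)
open import Function.Bundles using (Equivalence)
open import Relation.Nullary using (yes; no; ¬_)
open import Relation.Binary.PropositionalEquality hiding ([_])
open import Algebra.Properties.CommutativeSemigroup +-commutativeSemigroup using (interchange; x∙yz≈y∙xz)

open ≡-Reasoning

T-ext : {a b : Bool} → (T a → T b) → (T b → T a) → a ≡ b
T-ext {false} {false} _ _ = refl
T-ext {false} {true}  _ g = ⊥-elim (g tt)
T-ext {true}  {false} f _ = ⊥-elim (f tt)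
T-ext {true}  {true}  _ _ = refl

T⇒≡true : {b : Bool} → T b → b ≡ true
T⇒≡true = Equivalence.to T-≡

¬T⇒≡false : {b : Bool} → ¬ T b → b ≡ false
¬T⇒≡false {false} _ = refl
¬T⇒≡false {true}  f = ⊥-elim (f tt)

split-∧ : {a b : Bool} → T (a ∧ b) → T a × T b
split-∧ = Equivalence.to T-∧

-- A test ((d ∧ c) ∧ s) ∧ x guarded by s: once s holds, d holds and x may be
-- replaced by y.  This is the shape of the comparison of the two sides.
∧-guarded : {d c s x y : Bool} → (T s → d ≡ true) → (T s → x ≡ y) →
            ((d ∧ c) ∧ s) ∧ x ≡ (s ∧ c) ∧ y
∧-guarded {d} {c} {false} _ _ = cong (_∧ _) (∧-zeroʳ (d ∧ c))
∧-guarded {c = c} {true} d≡true x≡y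
  rewrite d≡true tt | x≡y tt | ∧-identityʳ c = refl

all-++ : {A : Set} (f : A → Bool) (xs ys : List A) → all f (xs ++ ys) ≡ all f xs ∧ all f ys
all-++ f []       ys = refl
all-++ f (x ∷ xs) ys = trans (cong (f x ∧_) (all-++ f xs ys)) (sym (∧-assoc (f x) _ _))

all-cong : {A : Set} {f g : A → Bool} → (∀ x → f x ≡ g x) → (xs : List A) → all f xs ≡ all g xs
all-cong h []       = refl
all-cong h (x ∷ xs) = cong₂ _∧_ (h x) (all-cong h xs)

all-mono : {A : Set} {f g : A → Bool} → (∀ x → T (f x) → T (g x)) →
           (xs : List A) → T (all f xs) → T (all g xs)
all-mono h []       _ = tt
all-mono h (x ∷ xs) t with split-∧ t
... | fx , fxs = Equivalence.from T-∧ (h x fx , all-mono h xs fxs)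

count-++ : {A : Set} (f : A → Bool) (xs ys : List A) → count f (xs ++ ys) ≡ count f xs + count f ys
count-++ f xs ys =
  trans (cong length (filter-++ (λ x → f x ≟ᵇ true) xs ys)) (length-++ (filter (λ x → f x ≟ᵇ true) xs))

count-cong : {A : Set} {f g : A → Bool} → (∀ x → f x ≡ g x) → (xs : List A) → count f xs ≡ count g xs
count-cong h [] = refl
count-cong {f = f} {g} h (x ∷ xs) with f x | g x | h x
... | true  | .true  | refl = cong suc (count-cong h xs)
... | false | .false | refl = count-cong h xs

count-none : {A : Set} {f : A → Bool} → (∀ x → f x ≡ false) → (xs : List A) → count f xs ≡ 0
count-none h [] = refl
count-none {f = f} h (x ∷ xs) with f x | h x
... | .false | refl = count-none h xs

count-filter : {A : Set} (f P : A → Bool) (xs : List A) →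
               count f (filter (λ q → P q ≟ᵇ true) xs) ≡ count (λ q → P q ∧ f q) xs
count-filter f P [] = refl
count-filter f P (x ∷ xs) with P x
... | false = count-filter f P xs
... | true with f x
...   | true  = cong suc (count-filter f P xs)
...   | false = count-filter f P xs

count-map : {A B : Set} (f : B → Bool) (h : A → B) (xs : List A) →
            count f (map h xs) ≡ count (λ x → f (h x)) xs
count-map f h [] = refl
count-map f h (x ∷ xs) with f (h x)
... | true  = cong suc (count-map f h xs)
... | false = count-map f h xs

count-concatMap : {A B : Set} (f : B → Bool) (g : A → List B) (xs : List A) →
                  count f (concatMap g xs) ≡ sum (map (λ x → count f (g x)) xs)
count-concatMap f g []       = refl
count-concatMap f g (x ∷ xs) =
  trans (count-++ f (g x) (concatMap g xs)) (cong (count f (g x) +_) (count-concatMap f g xs))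

count-interval : (x c K : ℕ) → count (λ i → (x ≤ᵇ i) ∧ (i <ᵇ c)) (upTo K) ≡ (K ⊓ c) ∸ x
count-interval x c zero = sym (0∸n≡0 x)
count-interval x c (suc K) = begin
    count test (upTo (suc K))
  ≡⟨ cong (count test) (sym (applyUpTo-∷ʳ (λ i → i) K)) ⟩
    count test (upTo K ∷ʳ K)
  ≡⟨ count-++ test (upTo K) [ K ] ⟩
    count test (upTo K) + count test [ K ]
  ≡⟨ cong (_+ count test [ K ]) (count-interval x c K) ⟩
    (K ⊓ c) ∸ x + count test [ K ]
  ≡⟨ lastIndex ⟩
    (suc K ⊓ c) ∸ x ∎
  where
  test : ℕ → Bool
  test i = (x ≤ᵇ i) ∧ (i <ᵇ c)
  lastIndex : (K ⊓ c) ∸ x + count test [ K ] ≡ (suc K ⊓ c) ∸ x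
  lastIndex with K <? c
  ... | no K≮c
    rewrite ¬T⇒≡false (λ t → K≮c (<ᵇ⇒< K c t)) | ∧-zeroʳ (x ≤ᵇ K)
          | m≥n⇒m⊓n≡n (≮⇒≥ K≮c) | m≥n⇒m⊓n≡n (m≤n⇒m≤1+n (≮⇒≥ K≮c)) = +-identityʳ (c ∸ x)
  ... | yes K<c
    rewrite T⇒≡true (<⇒<ᵇ K<c) | m≤n⇒m⊓n≡m (<⇒≤ K<c) | m≤n⇒m⊓n≡m K<c with x ≤? K
  ...   | yes x≤K rewrite T⇒≡true (≤⇒≤ᵇ x≤K) = trans (+-comm (K ∸ x) 1) (sym (+-∸-assoc 1 x≤K))
  ...   | no  x≰K rewrite ¬T⇒≡false (λ t → x≰K (≤ᵇ⇒≤ x K t)) =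
          trans (+-identityʳ (K ∸ x)) (trans (m≤n⇒m∸n≡0 (<⇒≤ (≰⇒> x≰K))) (sym (m≤n⇒m∸n≡0 (≰⇒> x≰K))))

sumW : ℕ → ℕ → (Path → ℕ) → ℕ
sumW a b f = sum (map f (words a b))

eastSteps : Path → ℕ
eastSteps []      = 0
eastSteps (N ∷ p) = eastSteps p
eastSteps (E ∷ p) = suc (eastSteps p)

northSteps : Path → ℕ
northSteps []      = 0
northSteps (N ∷ p) = suc (northSteps p)
northSteps (E ∷ p) = northSteps p

-- onPred g a = g (a - 1) for a ≥ 1, and 0 for a = 0: the words whose first
-- (or last) step is East number zero when there are no East steps.
onPred : (ℕ → ℕ) → ℕ → ℕ
onPred g zero    = 0
onPred g (suc a) = g a

sum-map-∘ : {A B : Set} (f : B → ℕ) (g : A → B) (xs : List A) →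
            sum (map f (map g xs)) ≡ sum (map (λ x → f (g x)) xs)
sum-map-∘ f g xs = cong sum (sym (map-∘ xs))

sumW-firstStep : (a b : ℕ) (f : Path → ℕ) → 0 < a + b →
  sumW a b f ≡ onPred (λ a′ → sumW a′ b (λ p → f (E ∷ p))) a
             + onPred (λ b′ → sumW a b′ (λ p → f (N ∷ p))) b
sumW-firstStep zero    (suc b) f _ = sum-map-∘ f (N ∷_) (words 0 b)
sumW-firstStep (suc a) zero    f _ = trans (sum-map-∘ f (E ∷_) (words a 0)) (sym (+-identityʳ _))
sumW-firstStep (suc a) (suc b) f _ =
  trans (cong sum (map-++ f (map (E ∷_) (words a (suc b))) (map (N ∷_) (words (suc a) b))))
  (trans (sum-++ (map f (map (E ∷_) (words a (suc b)))) (map f (map (N ∷_) (words (suc a) b))))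
         (cong₂ _+_ (sum-map-∘ f (E ∷_) (words a (suc b))) (sum-map-∘ f (N ∷_) (words (suc a) b))))

sumW-lastStep : (a b : ℕ) (f : Path → ℕ) → 0 < a + b →
  sumW a b f ≡ onPred (λ a′ → sumW a′ b (λ p → f (p ∷ʳ E))) a
             + onPred (λ b′ → sumW a b′ (λ p → f (p ∷ʳ N))) b
sumW-lastStep zero          (suc zero)    f _ = refl
sumW-lastStep (suc zero)    zero          f _ = sym (+-identityʳ _)
sumW-lastStep zero          (suc (suc b)) f _ = begin
    sumW 0 (suc (suc b)) f
  ≡⟨ sumW-firstStep 0 (suc (suc b)) f z<s ⟩
    sumW 0 (suc b) (λ p → f (N ∷ p))
  ≡⟨ sumW-lastStep 0 (suc b) (λ p → f (N ∷ p)) z<s ⟩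
    sumW 0 b (λ p → f (N ∷ p ∷ʳ N))
  ≡⟨ sym (sumW-firstStep 0 (suc b) (λ p → f (p ∷ʳ N)) z<s) ⟩
    sumW 0 (suc b) (λ p → f (p ∷ʳ N)) ∎
sumW-lastStep (suc (suc a)) zero          f _ = begin
    sumW (suc (suc a)) 0 f
  ≡⟨ sumW-firstStep (suc (suc a)) 0 f z<s ⟩
    sumW (suc a) 0 (λ p → f (E ∷ p)) + 0
  ≡⟨ cong (_+ 0) (sumW-lastStep (suc a) 0 (λ p → f (E ∷ p)) z<s) ⟩
    (sumW a 0 (λ p → f (E ∷ p ∷ʳ E)) + 0) + 0
  ≡⟨ cong (_+ 0) (sym (sumW-firstStep (suc a) 0 (λ p → f (p ∷ʳ E)) z<s)) ⟩
    sumW (suc a) 0 (λ p → f (p ∷ʳ E)) + 0 ∎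
sumW-lastStep (suc a)       (suc b)       f _ = begin
    sumW (suc a) (suc b) f
  ≡⟨ sumW-firstStep (suc a) (suc b) f z<s ⟩
    sumW a (suc b) fE + sumW (suc a) b fN
  ≡⟨ cong₂ _+_ (sumW-lastStep a (suc b) fE nonempty)
               (sumW-lastStep (suc a) b fN z<s) ⟩
    (EE + sumW a b (λ p → f (E ∷ p ∷ʳ N))) + (sumW a b (λ p → f (N ∷ p ∷ʳ E)) + NN)
  ≡⟨ interchange EE _ _ NN ⟩
    (EE + sumW a b (λ p → f (N ∷ p ∷ʳ E))) + (sumW a b (λ p → f (E ∷ p ∷ʳ N)) + NN)
  ≡⟨ sym (cong₂ _+_ (sumW-firstStep a (suc b) (λ p → f (p ∷ʳ E)) nonempty)
                    (sumW-firstStep (suc a) b (λ p → f (p ∷ʳ N)) z<s)) ⟩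
    sumW a (suc b) (λ p → f (p ∷ʳ E)) + sumW (suc a) b (λ p → f (p ∷ʳ N)) ∎
  where
  nonempty : 0 < a + suc b
  nonempty = <-≤-trans z<s (m≤n+m (suc b) a)
  fE fN : Path → ℕ
  fE p = f (E ∷ p)
  fN p = f (N ∷ p)
  EE NN : ℕ
  EE = onPred (λ a′ → sumW a′ (suc b) (λ p → f (E ∷ p ∷ʳ E))) a
  NN = onPred (λ b′ → sumW (suc a) b′ (λ p → f (N ∷ p ∷ʳ N))) b

sumW-cong : (a b : ℕ) {f g : Path → ℕ} →
  (∀ p → eastSteps p ≡ a → northSteps p ≡ b → f p ≡ g p) → sumW a b f ≡ sumW a b g
sumW-cong zero zero h = cong (_+ 0) (h [] refl refl)
sumW-cong zero (suc b) {f} {g} h = begin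
    sumW 0 (suc b) f
  ≡⟨ sumW-firstStep 0 (suc b) f z<s ⟩
    sumW 0 b (λ p → f (N ∷ p))
  ≡⟨ sumW-cong 0 b (λ p e n → h (N ∷ p) e (cong suc n)) ⟩
    sumW 0 b (λ p → g (N ∷ p))
  ≡⟨ sym (sumW-firstStep 0 (suc b) g z<s) ⟩
    sumW 0 (suc b) g ∎
sumW-cong (suc a) zero {f} {g} h = begin
    sumW (suc a) 0 f
  ≡⟨ sumW-firstStep (suc a) 0 f z<s ⟩
    sumW a 0 (λ p → f (E ∷ p)) + 0
  ≡⟨ cong (_+ 0) (sumW-cong a 0 (λ p e n → h (E ∷ p) (cong suc e) n)) ⟩
    sumW a 0 (λ p → g (E ∷ p)) + 0
  ≡⟨ sym (sumW-firstStep (suc a) 0 g z<s) ⟩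
    sumW (suc a) 0 g ∎
sumW-cong (suc a) (suc b) {f} {g} h = begin
    sumW (suc a) (suc b) f
  ≡⟨ sumW-firstStep (suc a) (suc b) f z<s ⟩
    sumW a (suc b) (λ p → f (E ∷ p)) + sumW (suc a) b (λ p → f (N ∷ p))
  ≡⟨ cong₂ _+_ (sumW-cong a (suc b) (λ p e n → h (E ∷ p) (cong suc e) n))
               (sumW-cong (suc a) b (λ p e n → h (N ∷ p) e (cong suc n))) ⟩
    sumW a (suc b) (λ p → g (E ∷ p)) + sumW (suc a) b (λ p → g (N ∷ p))
  ≡⟨ sym (sumW-firstStep (suc a) (suc b) g z<s) ⟩
    sumW (suc a) (suc b) g ∎

sumW-zero : (a b : ℕ) {f : Path → ℕ} →
  (∀ p → eastSteps p ≡ a → northSteps p ≡ b → f p ≡ 0) → sumW a b f ≡ 0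
sumW-zero a b h = trans (sumW-cong a b h) (sum-zeros (words a b))
  where
  sum-zeros : (ps : List Path) → sum (map (λ _ → 0) ps) ≡ 0
  sum-zeros []       = refl
  sum-zeros (_ ∷ ps) = sum-zeros ps

stepFrom : Step → ℕ × ℕ → ℕ × ℕ
stepFrom N (x , y) = x , suc y
stepFrom E (x , y) = suc x , y

endFrom : ℕ → ℕ → Path → ℕ × ℕ
endFrom x y []      = x , y
endFrom x y (N ∷ p) = endFrom x (suc y) p
endFrom x y (E ∷ p) = endFrom (suc x) y p

endFrom-counts : (x y : ℕ) (p : Path) → endFrom x y p ≡ (x + eastSteps p , y + northSteps p)
endFrom-counts x y []      = sym (cong₂ _,_ (+-identityʳ x) (+-identityʳ y))
endFrom-counts x y (N ∷ p) = trans (endFrom-counts x (suc y) p) (cong (x + eastSteps p ,_) (sym (+-suc y _)))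
endFrom-counts x y (E ∷ p) = trans (endFrom-counts (suc x) y p) (cong (_, y + northSteps p) (sym (+-suc x _)))

pointsFrom-∷ʳ : (x y : ℕ) (p : Path) (s : Step) →
  pointsFrom x y (p ∷ʳ s) ≡ pointsFrom x y p ∷ʳ stepFrom s (endFrom x y p)
pointsFrom-∷ʳ x y []      N = refl
pointsFrom-∷ʳ x y []      E = refl
pointsFrom-∷ʳ x y (N ∷ p) s = cong ((x , suc y) ∷_) (pointsFrom-∷ʳ x (suc y) p s)
pointsFrom-∷ʳ x y (E ∷ p) s = cong ((suc x , y) ∷_) (pointsFrom-∷ʳ (suc x) y p s)

endFrom-visited : (f : ℕ × ℕ → Bool) (x y : ℕ) (p : Path) →
  T (all f ((x , y) ∷ pointsFrom x y p)) → T (f (endFrom x y p))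
endFrom-visited f x y []      t = proj₁ (split-∧ {f (x , y)} t)
endFrom-visited f x y (N ∷ p) t = endFrom-visited f x (suc y) p (proj₂ (split-∧ {f (x , y)} t))
endFrom-visited f x y (E ∷ p) t = endFrom-visited f (suc x) y p (proj₂ (split-∧ {f (x , y)} t))

isDyck-∷ʳ : (a b : ℕ) (p : Path) (s : Step) →
  isDyckPath a b (p ∷ʳ s) ≡ isDyckPath a b p ∧ weaklyAbove a b (stepFrom s (endFrom 0 0 p))
isDyck-∷ʳ a b p s = begin
    all above ((0 , 0) ∷ pointsFrom 0 0 (p ∷ʳ s))
  ≡⟨ cong (λ ps → all above ((0 , 0) ∷ ps)) (pointsFrom-∷ʳ 0 0 p s) ⟩
    all above (points p ++ [ last ])
  ≡⟨ all-++ above (points p) [ last ] ⟩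
    isDyckPath a b p ∧ (above last ∧ true)
  ≡⟨ cong (isDyckPath a b p ∧_) (∧-identityʳ (above last)) ⟩
    isDyckPath a b p ∧ above last ∎
  where
  above : ℕ × ℕ → Bool
  above = weaklyAbove a b
  last : ℕ × ℕ
  last = stepFrom s (endFrom 0 0 p)

strict : ℕ × ℕ → Bool
strict (x , y) = x <ᵇ y

StrictlyAbove : Path → Bool
StrictlyAbove p = all strict (pointsFrom 0 0 p)

interior-∷ʳ : (z : ℕ × ℕ) (zs : List (ℕ × ℕ)) (w : ℕ × ℕ) → interior (z ∷ (zs ∷ʳ w)) ≡ zs
interior-∷ʳ z []            w = refl
interior-∷ʳ z (a ∷ [])      w = refl
interior-∷ʳ z (a ∷ b ∷ zs)  w = cong (a ∷_) (interior-∷ʳ z (b ∷ zs) w)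

touchesOnlyEnds-∷ʳ : (p : Path) (s : Step) → touchesOnlyEnds (p ∷ʳ s) ≡ StrictlyAbove p
touchesOnlyEnds-∷ʳ p s = begin
    touchesOnlyEnds (p ∷ʳ s)
  ≡⟨ all-cong (λ { (x , y) → refl }) (interior (points (p ∷ʳ s))) ⟩
    all strict (interior ((0 , 0) ∷ pointsFrom 0 0 (p ∷ʳ s)))
  ≡⟨ cong (λ ps → all strict (interior ((0 , 0) ∷ ps))) (pointsFrom-∷ʳ 0 0 p s) ⟩
    all strict (interior ((0 , 0) ∷ (pointsFrom 0 0 p ∷ʳ stepFrom s (endFrom 0 0 p))))
  ≡⟨ cong (all strict) (interior-∷ʳ (0 , 0) (pointsFrom 0 0 p) (stepFrom s (endFrom 0 0 p))) ⟩
    StrictlyAbove p ∎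

northXs-∷ʳE : (x : ℕ) (p : Path) → northXsFrom x (p ∷ʳ E) ≡ northXsFrom x p
northXs-∷ʳE x []      = refl
northXs-∷ʳE x (N ∷ p) = cong (x ∷_) (northXs-∷ʳE x p)
northXs-∷ʳE x (E ∷ p) = northXs-∷ʳE (suc x) p

steep⇒strict : (m : ℕ) {x y : ℕ} → suc m * x ≤ m * y → 0 < x ⊎ 0 < y → x < y
steep⇒strict m {x} {y} above nonzero with x <? y
... | yes x<y = x<y
... | no  x≮y = ⊥-elim (notOrigin nonzero)
  where
  x≤0 : x ≤ 0
  x≤0 = +-cancelʳ-≤ (m * x) x 0 (≤-trans above (*-monoʳ-≤ m (≮⇒≥ x≮y)))
  notOrigin : 0 < x ⊎ 0 < y → ⊥
  notOrigin (inj₁ 0<x) = <-irrefl refl (<-≤-trans 0<x x≤0)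
  notOrigin (inj₂ 0<y) = <-irrefl refl (<-≤-trans 0<y (≤-trans (≮⇒≥ x≮y) x≤0))

-- Left of the line x = m + 1, strictly above the diagonal implies weakly
-- above the steep line: (m+1)x = mx + x ≤ mx + m = m(x+1) ≤ my.
strict⇒steep : (m : ℕ) {x y : ℕ} → x ≤ m → x < y → suc m * x ≤ m * y
strict⇒steep m {x} {y} x≤m x<y =
  ≤-trans (+-monoˡ-≤ (m * x) x≤m) (≤-trans (≤-reflexive (sym (*-suc m x))) (*-monoʳ-≤ m x<y))

weaklyAbove-steep : (m x y : ℕ) → x ≤ m → 0 < x ⊎ 0 < y → weaklyAbove m (suc m) (x , y) ≡ strict (x , y)
weaklyAbove-steep m x y x≤m nonzero =
  T-ext (λ t → <⇒<ᵇ (steep⇒strict m (≤ᵇ⇒≤ (suc m * x) (m * y) t) nonzero))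
        (λ t → ≤⇒≤ᵇ (strict⇒steep m x≤m (<ᵇ⇒< x y t)))

-- The points visited from (x,y) have abscissa at most x + eastSteps p and
-- are not the origin, so the two tests agree along the whole path.
pointsFrom-steep : (m x y : ℕ) (p : Path) → x + eastSteps p ≤ m →
  all (weaklyAbove m (suc m)) (pointsFrom x y p) ≡ all strict (pointsFrom x y p)
pointsFrom-steep m x y []      _ = refl
pointsFrom-steep m x y (N ∷ p) h =
  cong₂ _∧_ (weaklyAbove-steep m x (suc y) (m+n≤o⇒m≤o x h) (inj₂ z<s)) (pointsFrom-steep m x (suc y) p h)
pointsFrom-steep m x y (E ∷ p) h =
  cong₂ _∧_ (weaklyAbove-steep m (suc x) y (m+n≤o⇒m≤o (suc x) h′) (inj₁ z<s)) (pointsFrom-steep m (suc x) y p h′)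
  where
  h′ : suc x + eastSteps p ≤ m
  h′ = subst (_≤ m) (+-suc x (eastSteps p)) h

isDyck-steep : (m : ℕ) (p : Path) → eastSteps p ≤ m → isDyckPath m (suc m) p ≡ StrictlyAbove p
isDyck-steep m p h rewrite *-zeroʳ m = pointsFrom-steep m 0 0 p h

strict⇒diagonal : (n : ℕ) (z : ℕ × ℕ) → T (strict z) → T (weaklyAbove n n z)
strict⇒diagonal n (x , y) t = ≤⇒≤ᵇ (*-monoʳ-≤ n (<⇒≤ (<ᵇ⇒< x y t)))

isDyck-∷ʳE : (m : ℕ) (p : Path) → eastSteps p ≡ m → northSteps p ≡ suc m →
  T (StrictlyAbove p) → isDyckPath (suc m) (suc m) (p ∷ʳ E) ≡ true
isDyck-∷ʳE m p e n t = begin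
    isDyckPath (suc m) (suc m) (p ∷ʳ E)
  ≡⟨ isDyck-∷ʳ (suc m) (suc m) p E ⟩
    isDyckPath (suc m) (suc m) p ∧ weaklyAbove (suc m) (suc m) (stepFrom E (endFrom 0 0 p))
  ≡⟨ cong₂ _∧_ (T⇒≡true dyck) (cong (λ z → weaklyAbove (suc m) (suc m) (stepFrom E z)) end) ⟩
    true ∧ weaklyAbove (suc m) (suc m) (suc m , suc m)
  ≡⟨ T⇒≡true (≤⇒≤ᵇ (≤-refl {suc m * suc m})) ⟩
    true ∎
  where
  end : endFrom 0 0 p ≡ (m , suc m)
  end = trans (endFrom-counts 0 0 p) (cong₂ _,_ e n)
  dyck : T (isDyckPath (suc m) (suc m) p)
  dyck rewrite *-zeroʳ m = all-mono (strict⇒diagonal (suc m)) (pointsFrom 0 0 p) t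

-- A path ending with N comes from (m+1, m), below the diagonal.
isDyck-∷ʳN : (m : ℕ) (p : Path) → eastSteps p ≡ suc m → northSteps p ≡ m →
  isDyckPath (suc m) (suc m) (p ∷ʳ N) ≡ false
isDyck-∷ʳN m p e n =
  trans (isDyck-∷ʳ (suc m) (suc m) p N)
        (cong (_∧ weaklyAbove (suc m) (suc m) (stepFrom N (endFrom 0 0 p))) (¬T⇒≡false notDyck))
  where
  end : endFrom 0 0 p ≡ (suc m , m)
  end = trans (endFrom-counts 0 0 p) (cong₂ _,_ e n)
  notDyck : ¬ T (isDyckPath (suc m) (suc m) p)
  notDyck t = <-irrefl refl (*-cancelˡ-≤ (suc m) (≤ᵇ⇒≤ (suc m * suc m) (suc m * m) endAbove))
    where
    endAbove : T (weaklyAbove (suc m) (suc m) (suc m , m))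
    endAbove = subst (λ z → T (weaklyAbove (suc m) (suc m) z)) end
                     (endFrom-visited (weaklyAbove (suc m) (suc m)) 0 0 p t)

rowCells-diagonal : (n j z : ℕ) → rowCells (suc n) (suc n) j z ≡ (suc n ⊓ j) ∸ z
rowCells-diagonal n j z =
  trans (count-cong (λ i → cong ((z ≤ᵇ i) ∧_) (below i)) (upTo (suc n))) (count-interval z j (suc n))
  where
  below : (i : ℕ) → (suc n * suc i ≤ᵇ suc n * j) ≡ (i <ᵇ j)
  below i = T-ext (λ t → <⇒<ᵇ (*-cancelˡ-≤ (suc n) (≤ᵇ⇒≤ (suc n * suc i) (suc n * j) t)))
                  (λ t → ≤⇒≤ᵇ (*-monoʳ-≤ (suc n) (<ᵇ⇒< i j t)))

rowCells-steep : (m j z : ℕ) → j ≤ suc m → rowCells m (suc m) j z ≡ (m ⊓ (j ∸ 1)) ∸ z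
rowCells-steep m j z j≤ =
  trans (count-cong (λ i → cong ((z ≤ᵇ i) ∧_) (below i j j≤)) (upTo m)) (count-interval z (j ∸ 1) m)
  where
  below : (i j : ℕ) → j ≤ suc m → (suc m * suc i ≤ᵇ m * j) ≡ (i <ᵇ j ∸ 1)
  below i zero    _  = ¬T⇒≡false (λ t → n≮0 (steep⇒strict m (≤ᵇ⇒≤ (suc m * suc i) (m * 0) t) (inj₁ z<s)))
  below i (suc j) j≤ =
    T-ext (λ t → <⇒<ᵇ (≤-pred (steep⇒strict m (≤ᵇ⇒≤ (suc m * suc i) (m * suc j) t) (inj₁ z<s))))
          (λ t → ≤⇒≤ᵇ (strict⇒steep m (≤-trans (<ᵇ⇒< i j t) (≤-pred j≤)) (s≤s (<ᵇ⇒< i j t))))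

row-loses-one : (m j z : ℕ) → z < j → j ≤ suc m →
  rowCells (suc m) (suc m) j z ≡ suc (rowCells m (suc m) j z)
row-loses-one m (suc r) z (s≤s z≤r) j≤
  rewrite rowCells-diagonal m (suc r) z | rowCells-steep m (suc r) z j≤ | m≥n⇒m⊓n≡n (≤-pred j≤) =
  +-∸-assoc 1 z≤r

row-zero : (m : ℕ) → rowCells (suc m) (suc m) 0 0 ≡ rowCells m (suc m) 0 0
row-zero m = trans (rowCells-diagonal m 0 0) (sym (trans (rowCells-steep m 0 0 z≤n) (⊓-zeroʳ m)))

cells-strict : (m x y : ℕ) (p : Path) → x < y → y + northSteps p ≤ suc m →
  T (all strict (pointsFrom x y p)) →
  cellsFrom (suc m) (suc m) y (northXsFrom x p) ≡ northSteps p + cellsFrom m (suc m) y (northXsFrom x p)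
cells-strict m x y []      _   _     _ = refl
cells-strict m x y (N ∷ p) x<y bound t = begin
    rowCells (suc m) (suc m) y x + cellsFrom (suc m) (suc m) (suc y) xs
  ≡⟨ cong₂ _+_ (row-loses-one m y x x<y (m+n≤o⇒m≤o y bound))
               (cells-strict m x (suc y) p (m<n⇒m<1+n x<y) (subst (_≤ suc m) (+-suc y _) bound)
                             (proj₂ (split-∧ t))) ⟩
    suc (rowCells m (suc m) y x) + (northSteps p + cellsFrom m (suc m) (suc y) xs)
  ≡⟨ cong suc (x∙yz≈y∙xz (rowCells m (suc m) y x) (northSteps p) _) ⟩
    suc (northSteps p) + (rowCells m (suc m) y x + cellsFrom m (suc m) (suc y) xs) ∎
  where
  xs : List ℕ
  xs = northXsFrom x p
cells-strict m x y (E ∷ p) x<y bound t with split-∧ t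
... | head , rest = cells-strict m (suc x) y p (<ᵇ⇒< (suc x) y head) bound rest

area-∷ʳE : (m : ℕ) (p : Path) → northSteps p ≡ suc m → T (StrictlyAbove p) →
  area (suc m) (p ∷ʳ E) ≡ m + rarea m (suc m) p
area-∷ʳE m []      ()
area-∷ʳE m (E ∷ p) _ ()
area-∷ʳE m (N ∷ p) n t = begin
    rowCells (suc m) (suc m) 0 0 + cellsFrom (suc m) (suc m) 1 (northXsFrom 0 (p ∷ʳ E))
  ≡⟨ cong₂ _+_ (row-zero m) (cong (cellsFrom (suc m) (suc m) 1) (northXs-∷ʳE 0 p)) ⟩
    row₀ + cellsFrom (suc m) (suc m) 1 (northXsFrom 0 p)
  ≡⟨ cong (row₀ +_) (cells-strict m 0 1 p z<s (≤-reflexive n) t) ⟩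
    row₀ + (northSteps p + cellsFrom m (suc m) 1 (northXsFrom 0 p))
  ≡⟨ x∙yz≈y∙xz row₀ (northSteps p) _ ⟩
    northSteps p + (row₀ + cellsFrom m (suc m) 1 (northXsFrom 0 p))
  ≡⟨ cong (_+ rarea m (suc m) (N ∷ p)) (suc-injective n) ⟩
    m + rarea m (suc m) (N ∷ p) ∎
  where
  row₀ : ℕ
  row₀ = rowCells m (suc m) 0 0

validLabellings : ℕ → (LabeledPath → Bool) → Path → ℕ
validLabellings b P p = count (λ ls → P (p , ls)) (perms (oneTo b))

gf-candidates : (a b : ℕ) (P : LabeledPath → Bool) (s : LabeledPath → ℕ) (k : ℕ) →
  gf (filter (λ q → P q ≟ᵇ true) (candidates a b)) s k
    ≡ sumW a b (validLabellings b (λ q → P q ∧ (s q ≡ᵇ k)))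
gf-candidates a b P s k =
  trans (count-filter (λ q → s q ≡ᵇ k) P (candidates a b))
  (trans (count-concatMap test (λ p → map (p ,_) (perms (oneTo b))) (words a b))
         (cong sum (map-cong (λ p → count-map test (p ,_) (perms (oneTo b))) (words a b))))
  where
  test : LabeledPath → Bool
  test q = P q ∧ (s q ≡ᵇ k)

shift-≡ᵇ : (m a k : ℕ) → m ≤ k → (m + a ≡ᵇ k) ≡ (a ≡ᵇ k ∸ m)
shift-≡ᵇ m a k m≤k =
  T-ext (λ t → ≡⇒≡ᵇ a (k ∸ m) (trans (sym (m+n∸m≡n m a)) (cong (_∸ m) (≡ᵇ⇒≡ (m + a) k t))))
        (λ t → ≡⇒≡ᵇ (m + a) k (trans (cong (m +_) (≡ᵇ⇒≡ a (k ∸ m) t)) (m+[n∸m]≡n m≤k)))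

gf-shift : {A : Set} (xs : List A) (s : A → ℕ) (m k : ℕ) →
  gf xs (λ x → m + s x) k ≡ shiftT m (gf xs s) k
gf-shift xs s m k with m ≤? k
... | yes m≤k rewrite T⇒≡true (≤⇒≤ᵇ m≤k) = count-cong (λ x → shift-≡ᵇ m (s x) k m≤k) xs
... | no  m≰k rewrite ¬T⇒≡false (λ t → m≰k (≤ᵇ⇒≤ m k t)) =
  count-none (λ x → ¬T⇒≡false (λ t → m≰k (subst (m ≤_) (≡ᵇ⇒≡ (m + s x) k t) (m≤m+n m (s x))))) xs

EPF-test : ℕ → ℕ → LabeledPath → Bool
EPF-test m k q = (isPF (suc m) (suc m) q ∧ touchesOnlyEnds (proj₁ q)) ∧ (area (suc m) (proj₁ q) ≡ᵇ k)

Q-test : ℕ → ℕ → LabeledPath → Bool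
Q-test m k q = isPF m (suc m) q ∧ (m + rarea m (suc m) (proj₁ q) ≡ᵇ k)

endsEast : (m k : ℕ) (p : Path) → eastSteps p ≡ m → northSteps p ≡ suc m →
  (ls : List ℕ) → EPF-test m k (p ∷ʳ E , ls) ≡ Q-test m k (p , ls)
endsEast m k p e n ls = begin
    ((isDyckPath (suc m) (suc m) (p ∷ʳ E) ∧ colIncreasing (northXs (p ∷ʳ E)) ls) ∧ touchesOnlyEnds (p ∷ʳ E))
      ∧ (area (suc m) (p ∷ʳ E) ≡ᵇ k)
  ≡⟨ cong₂ (λ xs s → ((isDyckPath (suc m) (suc m) (p ∷ʳ E) ∧ colIncreasing xs ls) ∧ s) ∧ (area (suc m) (p ∷ʳ E) ≡ᵇ k))
           (northXs-∷ʳE 0 p) (touchesOnlyEnds-∷ʳ p E) ⟩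
    ((isDyckPath (suc m) (suc m) (p ∷ʳ E) ∧ labelled) ∧ StrictlyAbove p) ∧ (area (suc m) (p ∷ʳ E) ≡ᵇ k)
  ≡⟨ ∧-guarded (isDyck-∷ʳE m p e n) (λ t → cong (_≡ᵇ k) (area-∷ʳE m p n t)) ⟩
    (StrictlyAbove p ∧ labelled) ∧ (m + rarea m (suc m) p ≡ᵇ k)
  ≡⟨ cong (λ d → (d ∧ labelled) ∧ (m + rarea m (suc m) p ≡ᵇ k)) (sym (isDyck-steep m p (≤-reflexive e))) ⟩
    (isDyckPath m (suc m) p ∧ labelled) ∧ (m + rarea m (suc m) p ≡ᵇ k) ∎
  where
  labelled : Bool
  labelled = colIncreasing (northXs p) ls

endsNorth : (m k : ℕ) (p : Path) → eastSteps p ≡ suc m → northSteps p ≡ m →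
  (ls : List ℕ) → EPF-test m k (p ∷ʳ N , ls) ≡ false
endsNorth m k p e n ls =
  cong (λ d → ((d ∧ colIncreasing (northXs (p ∷ʳ N)) ls) ∧ touchesOnlyEnds (p ∷ʳ N)) ∧ (area (suc m) (p ∷ʳ N) ≡ᵇ k))
       (isDyck-∷ʳN m p e n)

EPF-area≡shifted-Q-rarea : (m k : ℕ) →
  gf (EPF (suc m)) (λ q → area (suc m) (proj₁ q)) k
    ≡ shiftT m (gf (Q m (suc m)) (λ q → rarea m (suc m) (proj₁ q))) k
EPF-area≡shifted-Q-rarea m k = begin
    gf (EPF (suc m)) (λ q → area (suc m) (proj₁ q)) k
  ≡⟨ gf-candidates (suc m) (suc m) (λ q → isPF (suc m) (suc m) q ∧ touchesOnlyEnds (proj₁ q))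
                   (λ q → area (suc m) (proj₁ q)) k ⟩
    sumW (suc m) (suc m) (validLabellings (suc m) (EPF-test m k))
  ≡⟨ sumW-lastStep (suc m) (suc m) (validLabellings (suc m) (EPF-test m k)) z<s ⟩
    sumW m (suc m) (λ p → validLabellings (suc m) (EPF-test m k) (p ∷ʳ E))
      + sumW (suc m) m (λ p → validLabellings (suc m) (EPF-test m k) (p ∷ʳ N))
  ≡⟨ cong₂ _+_ (sumW-cong m (suc m) (λ p e n → count-cong (endsEast m k p e n) (perms (oneTo (suc m)))))
               (sumW-zero (suc m) m (λ p e n → count-none (endsNorth m k p e n) (perms (oneTo (suc m))))) ⟩
    sumW m (suc m) (validLabellings (suc m) (Q-test m k)) + 0
  ≡⟨ +-identityʳ _ ⟩
    sumW m (suc m) (validLabellings (suc m) (Q-test m k))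
  ≡⟨ sym (gf-candidates m (suc m) (isPF m (suc m)) (λ q → m + rarea m (suc m) (proj₁ q)) k) ⟩
    gf (Q m (suc m)) (λ q → m + rarea m (suc m) (proj₁ q)) k
  ≡⟨ gf-shift (Q m (suc m)) (λ q → rarea m (suc m) (proj₁ q)) m k ⟩
    shiftT m (gf (Q m (suc m)) (λ q → rarea m (suc m) (proj₁ q))) k ∎

lemma4 : (n : ℕ) → 2 ≤ n → (k : ℕ) →
    gf (EPF n) (λ q → area n (proj₁ q)) k
      ≡ shiftT (n ∸ 1) (gf (Q (n ∸ 1) n) (λ q → rarea (n ∸ 1) n (proj₁ q))) k
lemma4 (suc zero)    (s≤s ()) k
lemma4 (suc (suc m)) _        k = EPF-area≡shifted-Q-rarea (suc m) k
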